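{- For all $\tau,\varepsilon\in(0,1)$ there exists $\nu_0>0$ such that for every $0<\nu\leq\nu_0$ there exists $n_0$ such that the following holds for all $n\geq n_0$. Let $G$ be a digraph on $n$ vertices with $\delta^0(G)\geq n/2$. Then $G$ is $\varepsilon$-extremal or $G$ is a robust $(\nu,\tau)$-outexpander.
   Context: Digraphs have no loops and at most one edge in each direction between two vertices; $\delta^0(G)$ is the minimum of all in- and outdegrees. For $X,Y\subseteq V(G)$, $E(X,Y)$ is the set of edges $xy$ with $x\in X$, $y\in Y$, and $e(X,Y)=|E(X,Y)|$. For $0<\nu\leq\tau<1$ and $S\subseteq V(G)$, the $\nu$-robust outneighbourhood $RN^+_{\nu,G}(S)$ is the set of vertices of $G$ having at least $\nu n$ inneighbours in $S$; $G$ is a robust $(\nu,\tau)$-outexpander if $|RN^+_{\nu,G}(S)|\geq |S|+\nu n$ for all $S\subseteq V(G)$ with $\tau n<|S|<(1-\tau)n$. $G$ is $\varepsilon$-extremal if there is a partition of $V(G)$ into sets $A,B,S,T$ of sizes $a,b,s,t$ with $|a-b|\leq 1$, $|s-t|\leq 1$ and $e(A\cup S, A\cup T)<\varepsilon n^2$. -}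

module Defs where

open import Data.Nat as ℕ using (ℕ; _≤_)
open import Data.Bool using (Bool; true; false; _∧_; _∨_; if_then_else_)
open import Data.Fin using (Fin)
open import Data.Fin.Subset using (Subset; ∣_∣)
open import Data.Vec using (tabulate; lookup)
open import Data.Integer using (+_)
open import Data.Rational using (ℚ; _/_; _*_; _+_; _-_; 1ℚ)
  renaming (_<_ to _<ℚ_; _≤_ to _≤ℚ_)
open import Data.Rational.Properties using (_≤?_)
open import Relation.Nullary.Decidable using (isYes)
open import Data.List as L using ()
open import Data.Nat.ListAction using (sum)
open import Data.Product using (_×_; Σ; ∃-syntax)
open import Relation.Binary.PropositionalEquality using (_≡_)

⟦_⟧ : ℕ → ℚ
⟦ n ⟧ = + n / 1

-- a digraph on vertex set Fin n: adjacency relation (edge u → v iff adj u v ≡ true),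
-- no loops; "at most one edge in each direction" is automatic.
record Digraph (n : ℕ) : Set where
  field
    adj      : Fin n → Fin n → Bool
    loopless : ∀ v → adj v v ≡ false
open Digraph public

count : ∀ {n} → (Fin n → Bool) → ℕ
count p = ∣ tabulate p ∣

outdeg : ∀ {n} → Digraph n → Fin n → ℕ
outdeg G v = count (λ w → adj G v w)

indeg : ∀ {n} → Digraph n → Fin n → ℕ
indeg G v = count (λ u → adj G u v)

MinSemiDegreeAtLeastHalf : ∀ {n} → Digraph n → Set
MinSemiDegreeAtLeastHalf {n} G =
  ∀ v → (n ≤ 2 ℕ.* outdeg G v) × (n ≤ 2 ℕ.* indeg G v)

inFrom : ∀ {n} → Digraph n → Subset n → Fin n → ℕ
inFrom G S w = count (λ u → lookup S u ∧ adj G u w)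

RN⁺ : ∀ {n} → ℚ → Digraph n → Subset n → Subset n
RN⁺ {n} ν G S = tabulate (λ w → isYes (ν * ⟦ n ⟧ ≤? ⟦ inFrom G S w ⟧))

RobustOutexpander : ∀ {n} → ℚ → ℚ → Digraph n → Set
RobustOutexpander {n} ν τ G =
  (S : Subset n) →
  τ * ⟦ n ⟧ <ℚ ⟦ ∣ S ∣ ⟧ →
  ⟦ ∣ S ∣ ⟧ <ℚ (1ℚ - τ) * ⟦ n ⟧ →
  ⟦ ∣ S ∣ ⟧ + ν * ⟦ n ⟧ ≤ℚ ⟦ ∣ RN⁺ ν G S ∣ ⟧

data Part : Set where
  pA pB pS pT : Part

isA isB isS isT : Part → Bool
isA pA = true
isA _  = false
isB pB = true
isB _  = false
isS pS = true
isS _  = false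
isT pT = true
isT _  = false

Close : ℕ → ℕ → Set
Close x y = (x ≤ ℕ.suc y) × (y ≤ ℕ.suc x)

e : ∀ {n} → Digraph n → (Fin n → Bool) → (Fin n → Bool) → ℕ
e G X Y = sum (L.map (λ x → if X x then count (λ y → Y y ∧ adj G x y) else 0)
                                      (L.allFin _))

Extremal : ∀ {n} → ℚ → Digraph n → Set
Extremal {n} ε G =
  Σ (Fin n → Part) λ f → ( Close (count (λ v → isA (f v))) (count (λ v → isB (f v)))
         × Close (count (λ v → isS (f v))) (count (λ v → isT (f v)))
         × ⟦ e G (λ v → isA (f v) ∨ isS (f v)) (λ v → isA (f v) ∨ isT (f v)) ⟧
             <ℚ ε * ⟦ n ℕ.* n ⟧ )

-- Write ν = p/q, let M be a common multiple of the denominators of τ and ε, and take ν ≤ 1/(16M²),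
-- n ≥ 8M. Suppose σ, with s = |σ| strictly between τn and (1-τ)n, has R = RN⁺(σ) of size < s + νn.
-- Double counting the edges leaving σ (at least n/2 per vertex of σ; at most s per vertex of R and
-- fewer than νn per vertex outside R) gives sn/2 ≤ e(σ,V) < (s + νn)s + νn². If s ≥ n/2 + νn, the
-- in-degree condition puts every vertex into R, contradicting s < (1-τ)n; if s ≤ n/2 - n/(8M), the double
-- count contradicts s > τn. Otherwise s and n - |R| are both close to n/2 while e(σ, V∖R) < νn², so
-- resizing σ and V∖R to sets X, Y of sizes ⌊n/2⌋, ⌈n/2⌉ costs few edges: e(X,Y) < n²/M ≤ εn². Then
-- A = X ∩ Y, S = X ∖ Y, T = Y ∖ X and B = V ∖ (X ∪ Y) form an ε-extremal partition.

module Submission where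

open import Defs
open import Data.Bool using (Bool; true; false; _∧_; _∨_; not; if_then_else_)
open import Data.Bool.Properties using (∧-zeroʳ)
open import Data.Empty using (⊥; ⊥-elim)
open import Data.Fin using (Fin; zero; suc)
open import Data.Fin.Subset using (Subset; ∣_∣)
open import Data.Fin.Subset.Properties using (anySubset?)
open import Data.Integer as ℤ using (-[1+_]; +≤+; +<+)
import Data.Integer.Properties as ℤₚ
import Data.List as L
open import Data.List using (_∷_; [])
open import Data.List.Properties using (map-tabulate)
open import Data.Nat as ℕ
  using (ℕ; zero; suc; NonZero; >-nonZero; >-nonZero⁻¹; _+_; _*_; _∸_; _≤_; _<_; z≤n; s≤s; ⌊_/2⌋; ⌈_/2⌉)
open import Data.Nat.ListAction using () renaming (sum to listSum)
open import Data.Nat.Properties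
open import Algebra.Properties.Semiring.Sum +-*-semiring
  using (sum; sum-syntax; sum-cong-≗; ∑-distrib-+; ∑-comm; *-distribˡ-sum; *-distribʳ-sum)
open import Data.Nat.Tactic.RingSolver using (solve)
open import Data.Product using (∃; ∃₂; ∃-syntax; _×_; _,_; proj₁; proj₂)
open import Data.Rational as ℚ using (ℚ; mkℚ; 0ℚ; 1ℚ; toℚᵘ; fromℚᵘ)
  renaming (_<_ to _<ℚ_; _≤_ to _≤ℚ_)
import Data.Rational.Properties as ℚₚ
open import Data.Rational.Unnormalised using (mkℚᵘ; *≡*; *≤*; *<*) renaming (_≃_ to _≃ᵘ_)
import Data.Rational.Unnormalised.Properties as ℚᵘₚ
open import Data.Sum as Sum using (_⊎_; inj₁; inj₂)
open import Data.Vec as Vec using (lookup)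
open import Data.Vec.Functional using () renaming (_∷_ to _◂_)
open import Function using (_∘_; id)
open import Relation.Binary.PropositionalEquality
open import Relation.Nullary using (¬_; Dec; yes; no)
open import Relation.Nullary.Decidable using (isYes; isYes≗does; dec-true; _×-dec_)

-- Finite sums and indicator counts

χ : Bool → ℕ
χ true  = 1
χ false = 0

χ≤1 : ∀ b → χ b ≤ 1
χ≤1 true  = ≤-refl
χ≤1 false = z≤n

#_ : ∀ {n} → (Fin n → Bool) → ℕ
# p = sum (χ ∘ p)

∑-mono-≤ : ∀ {n} {f g : Fin n → ℕ} → (∀ i → f i ≤ g i) → sum f ≤ sum g
∑-mono-≤ {zero}  f≤g = z≤n
∑-mono-≤ {suc n} f≤g = +-mono-≤ (f≤g zero) (∑-mono-≤ (f≤g ∘ suc))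

∑-const : ∀ n k → ∑[ i < n ] k ≡ n * k
∑-const zero    k = refl
∑-const (suc n) k = cong (k +_) (∑-const n k)

∑-≤-const : ∀ {n} {f : Fin n → ℕ} k → (∀ i → f i ≤ k) → sum f ≤ n * k
∑-≤-const {n} k f≤k = ≤-trans (∑-mono-≤ f≤k) (≤-reflexive (∑-const n k))

count≡# : ∀ {n} (p : Fin n → Bool) → count p ≡ # p
count≡# {zero}  p = refl
count≡# {suc n} p with p zero
... | true  = cong suc (count≡# (p ∘ suc))
... | false = count≡# (p ∘ suc)

∣S∣≡# : ∀ {n} (S : Subset n) → ∣ S ∣ ≡ # (lookup S)
∣S∣≡# Vec.[]          = refl
∣S∣≡# (true  Vec.∷ S) = cong suc (∣S∣≡# S)
∣S∣≡# (false Vec.∷ S) = ∣S∣≡# S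

#-cong : ∀ {n} {p q : Fin n → Bool} → (∀ i → p i ≡ q i) → # p ≡ # q
#-cong p≗q = sum-cong-≗ (cong χ ∘ p≗q)

#≤n : ∀ {n} (p : Fin n → Bool) → # p ≤ n
#≤n {n} p = ≤-trans (∑-≤-const 1 (χ≤1 ∘ p)) (≤-reflexive (*-identityʳ n))

#-empty : ∀ {n} → # (λ (_ : Fin n) → false) ≡ 0
#-empty {n} = trans (∑-const n 0) (*-zeroʳ n)

#-partition : ∀ {n} {p q r : Fin n → Bool} → (∀ i → χ (p i) + χ (q i) ≡ χ (r i)) → # p + # q ≡ # r
#-partition {p = p} {q} h = trans (sym (∑-distrib-+ (χ ∘ p) (χ ∘ q))) (sum-cong-≗ h)

#-complement : ∀ {n} (p : Fin n → Bool) → # (not ∘ p) + # p ≡ n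
#-complement {n} p = begin
  # (not ∘ p) + # p      ≡⟨ #-partition {r = λ _ → true} (χ-not ∘ p) ⟩
  ∑[ i < n ] 1           ≡⟨ ∑-const n 1 ⟩
  n * 1                  ≡⟨ *-identityʳ n ⟩
  n                      ∎
  where
  open ≡-Reasoning
  χ-not : ∀ b → χ (not b) + χ b ≡ 1
  χ-not true  = refl
  χ-not false = refl

#not≡n∸# : ∀ {n} (p : Fin n → Bool) → # (not ∘ p) ≡ n ∸ # p
#not≡n∸# p = trans (sym (m+n∸n≡m _ (# p))) (cong (_∸ # p) (#-complement p))

_∖_ : ∀ {n} → (Fin n → Bool) → (Fin n → Bool) → Fin n → Bool
(X ∖ P) i = X i ∧ not (P i)

#∖+#∧≡# : ∀ {n} (X P : Fin n → Bool) → # (X ∖ P) + # (λ i → X i ∧ P i) ≡ # X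
#∖+#∧≡# X P = #-partition (λ i → χ-split (X i) (P i))
  where
  χ-split : ∀ a b → χ (a ∧ not b) + χ (a ∧ b) ≡ χ a
  χ-split true  true  = refl
  χ-split true  false = refl
  χ-split false b     = refl

-- Sets of prescribed size nested with a given set

_⊆_ : ∀ {n} → (Fin n → Bool) → (Fin n → Bool) → Set
X ⊆ P = ∀ i → X i ≡ true → P i ≡ true

⊆⇒#∖≡0 : ∀ {n} {X P : Fin n → Bool} → X ⊆ P → # (X ∖ P) ≡ 0
⊆⇒#∖≡0 {n} {X} {P} X⊆P = trans (#-cong outside) (#-empty {n})
  where
  outside : ∀ i → X i ∧ not (P i) ≡ false
  outside i with X i in Xi
  ... | false = refl
  ... | true rewrite X⊆P i Xi = refl

⊇⇒#∖+#≡# : ∀ {n} {X P : Fin n → Bool} → P ⊆ X → # (X ∖ P) + # P ≡ # X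
⊇⇒#∖+#≡# {X = X} {P} P⊆X = trans (cong (# (X ∖ P) +_) (#-cong ∧-absorb)) (#∖+#∧≡# X P)
  where
  ∧-absorb : ∀ i → P i ≡ X i ∧ P i
  ∧-absorb i with P i in Pi
  ... | false = sym (∧-zeroʳ (X i))
  ... | true rewrite P⊆X i Pi = refl

◂-⊆ : ∀ {n} {b} {X : Fin n → Bool} {P : Fin (suc n) → Bool} →
      (b ≡ true → P zero ≡ true) → X ⊆ (P ∘ suc) → (b ◂ X) ⊆ P
◂-⊆ b⇒P₀ X⊆P zero    = b⇒P₀
◂-⊆ b⇒P₀ X⊆P (suc i) = X⊆P i

shrink : ∀ {n} (P : Fin n → Bool) k → k ≤ # P → ∃ λ X → # X ≡ k × X ⊆ P
shrink {n} P zero _ = (λ _ → false) , #-empty {n} , λ _ ()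
shrink {suc n} P (suc k) k<#P with P zero in P₀ | k<#P
... | true  | s≤s k≤#P with shrink (P ∘ suc) k k≤#P
...   | X , #X≡k , X⊆P = (true ◂ X) , cong suc #X≡k , ◂-⊆ (λ _ → P₀) X⊆P
shrink {suc n} P (suc k) k<#P | false | k<#P′ with shrink (P ∘ suc) (suc k) k<#P′
...   | X , #X≡k , X⊆P = (false ◂ X) , #X≡k , ◂-⊆ (λ ()) X⊆P

grow : ∀ {n} (P : Fin n → Bool) k → # P ≤ k → k ≤ n → ∃ λ X → # X ≡ k × P ⊆ X
grow {n} P k #P≤k k≤n with shrink (not ∘ P) (n ∸ k) n∸k≤#notP
  where
  n∸k≤#notP : n ∸ k ≤ # (not ∘ P)
  n∸k≤#notP = ≤-trans (∸-monoʳ-≤ n #P≤k) (≤-reflexive (sym (#not≡n∸# P)))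
... | Z , #Z≡n∸k , Z⊆notP = (not ∘ Z) , #notZ≡k , P⊆notZ
  where
  #notZ≡k : # (not ∘ Z) ≡ k
  #notZ≡k = trans (#not≡n∸# Z) (trans (cong (n ∸_) #Z≡n∸k) (m∸[m∸n]≡n k≤n))
  P⊆notZ : P ⊆ (not ∘ Z)
  P⊆notZ i Pi with Z i in Zi
  ... | false = refl
  ... | true with () ← trans (sym (cong not Pi)) (Z⊆notP i Zi)

∃-nested-of-size : ∀ {n} (P : Fin n → Bool) k → k ≤ n → ∃ λ X → # X ≡ k × (X ⊆ P ⊎ P ⊆ X)
∃-nested-of-size P k k≤n with ≤-total k (# P)
... | inj₁ k≤#P = let X , #X≡k , X⊆P = shrink P k k≤#P in X , #X≡k , inj₁ X⊆P
... | inj₂ #P≤k = let X , #X≡k , P⊆X = grow P k #P≤k k≤n in X , #X≡k , inj₂ P⊆X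

nested⇒#∖ : ∀ {n} {X P : Fin n → Bool} → X ⊆ P ⊎ P ⊆ X → # (X ∖ P) ≡ 0 ⊎ # (X ∖ P) + # P ≡ # X
nested⇒#∖ (inj₁ X⊆P) = inj₁ (⊆⇒#∖≡0 X⊆P)
nested⇒#∖ (inj₂ P⊆X) = inj₂ (⊇⇒#∖+#≡# P⊆X)

-- Edge counts

listSum-tabulate : ∀ {n} (f : Fin n → ℕ) → listSum (L.tabulate f) ≡ sum f
listSum-tabulate {zero}  f = refl
listSum-tabulate {suc n} f = cong (f zero +_) (listSum-tabulate (f ∘ suc))

e≡∑∑ : ∀ {n} (G : Digraph n) X Y → e G X Y ≡ ∑[ x < n ] ∑[ y < n ] χ (X x ∧ (Y y ∧ adj G x y))
e≡∑∑ {n} G X Y = begin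
  e G X Y                                       ≡⟨ cong listSum (map-tabulate id row) ⟩
  listSum (L.tabulate row)                      ≡⟨ listSum-tabulate row ⟩
  sum row                                       ≡⟨ sum-cong-≗ (λ x → row≡# (X x)) ⟩
  ∑[ x < n ] ∑[ y < n ] χ (X x ∧ (Y y ∧ adj G x y)) ∎
  where
  open ≡-Reasoning
  row : Fin n → ℕ
  row x = if X x then count (λ y → Y y ∧ adj G x y) else 0
  row≡# : ∀ {x} b → (if b then count (λ y → Y y ∧ adj G x y) else 0) ≡ # (λ y → b ∧ (Y y ∧ adj G x y))
  row≡# {x} true = count≡# (λ y → Y y ∧ adj G x y)
  row≡# false    = sym (#-empty {n})

e-cong : ∀ {n} (G : Digraph n) {X Y X′ Y′} → (∀ i → X i ≡ X′ i) → (∀ i → Y i ≡ Y′ i) → e G X Y ≡ e G X′ Y′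
e-cong G {X} {Y} {X′} {Y′} X≗X′ Y≗Y′ = begin
  e G X Y    ≡⟨ e≡∑∑ G X Y ⟩
  _          ≡⟨ sum-cong-≗ (λ x → sum-cong-≗ (λ y →
                  cong₂ (λ a b → χ (a ∧ (b ∧ adj G x y))) (X≗X′ x) (Y≗Y′ y))) ⟩
  _          ≡⟨ sym (e≡∑∑ G X′ Y′) ⟩
  e G X′ Y′  ∎
  where open ≡-Reasoning

∑-distrib-+₃ : ∀ {n} (f g h : Fin n → ℕ) → ∑[ i < n ] (f i + g i + h i) ≡ sum f + sum g + sum h
∑-distrib-+₃ f g h = trans (∑-distrib-+ (λ i → f i + g i) h) (cong (_+ sum h) (∑-distrib-+ f g))

e-≤-perturb : ∀ {n} (G : Digraph n) X Y X′ Y′ →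
  e G X Y ≤ e G X′ Y′ + n * # (X ∖ X′) + n * # (Y ∖ Y′)
e-≤-perturb {n} G X Y X′ Y′ = begin
  e G X Y                                          ≡⟨ e≡∑∑ G X Y ⟩
  ∑[ x < n ] ∑[ y < n ] χ (X x ∧ (Y y ∧ adj G x y))
    ≤⟨ ∑-mono-≤ (λ x → ∑-mono-≤ (λ y → χ-perturb (X x) (X′ x) (Y y) (Y′ y) (adj G x y))) ⟩
  ∑[ x < n ] ∑[ y < n ] (E′ x y + χ ((X ∖ X′) x) + χ ((Y ∖ Y′) y))
    ≡⟨ sum-cong-≗ (λ x → ∑-distrib-+₃ (E′ x) (λ _ → χ ((X ∖ X′) x)) (χ ∘ (Y ∖ Y′))) ⟩
  ∑[ x < n ] (sum (E′ x) + ∑[ y < n ] χ ((X ∖ X′) x) + # (Y ∖ Y′))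
    ≡⟨ sum-cong-≗ (λ x → cong (λ z → sum (E′ x) + z + # (Y ∖ Y′)) (∑-const n (χ ((X ∖ X′) x)))) ⟩
  ∑[ x < n ] (sum (E′ x) + n * χ ((X ∖ X′) x) + # (Y ∖ Y′))
    ≡⟨ ∑-distrib-+₃ (sum ∘ E′) (λ x → n * χ ((X ∖ X′) x)) (λ _ → # (Y ∖ Y′)) ⟩
  sum (sum ∘ E′) + ∑[ x < n ] (n * χ ((X ∖ X′) x)) + ∑[ x < n ] # (Y ∖ Y′)
    ≡⟨ cong₂ _+_ (cong₂ _+_ (sym (e≡∑∑ G X′ Y′)) (sym (*-distribˡ-sum n (χ ∘ (X ∖ X′)))))
                 (∑-const n (# (Y ∖ Y′))) ⟩
  e G X′ Y′ + n * # (X ∖ X′) + n * # (Y ∖ Y′)      ∎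
  where
  open ≤-Reasoning
  E′ : Fin n → Fin n → ℕ
  E′ x y = χ (X′ x ∧ (Y′ y ∧ adj G x y))
  χ-perturb : ∀ a a′ b b′ c → χ (a ∧ (b ∧ c)) ≤ χ (a′ ∧ (b′ ∧ c)) + χ (a ∧ not a′) + χ (b ∧ not b′)
  χ-perturb true  true  true  true  true = ≤-refl
  χ-perturb true  false true  b′    true = m≤m+n 1 _
  χ-perturb true  true  true  false true = ≤-refl
  χ-perturb false _     _     _     _    = z≤n
  χ-perturb true  a′    false _     _    = z≤n
  χ-perturb true  a′    true  b′    false = z≤n

-- Extremal partitions from two halves

label : Bool → Bool → Part
label true  true  = pA
label true  false = pS
label false true  = pT
label false false = pB

label-parts : ∀ a b →
  (χ (isS (label a b)) + χ (isA (label a b)) ≡ χ a) ×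
  (χ (isT (label a b)) + χ (isA (label a b)) ≡ χ b) ×
  (χ (isB (label a b)) + χ (isT (label a b)) ≡ χ (not a)) ×
  (isA (label a b) ∨ isS (label a b) ≡ a) ×
  (isA (label a b) ∨ isT (label a b) ≡ b)
label-parts true  true  = refl , refl , refl , refl , refl
label-parts true  false = refl , refl , refl , refl , refl
label-parts false true  = refl , refl , refl , refl , refl
label-parts false false = refl , refl , refl , refl , refl

⌈n/2⌉≤1+⌊n/2⌋ : ∀ n → ⌈ n /2⌉ ≤ suc ⌊ n /2⌋
⌈n/2⌉≤1+⌊n/2⌋ zero          = z≤n
⌈n/2⌉≤1+⌊n/2⌋ (suc zero)    = ≤-refl
⌈n/2⌉≤1+⌊n/2⌋ (suc (suc n)) = s≤s (⌈n/2⌉≤1+⌊n/2⌋ n)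

n∸⌊n/2⌋≡⌈n/2⌉ : ∀ n → n ∸ ⌊ n /2⌋ ≡ ⌈ n /2⌉
n∸⌊n/2⌋≡⌈n/2⌉ n = trans (cong (_∸ ⌊ n /2⌋) (sym (⌊n/2⌋+⌈n/2⌉≡n n))) (m+n∸m≡n ⌊ n /2⌋ ⌈ n /2⌉)

⌊n/2⌋+⌊n/2⌋≤n : ∀ n → ⌊ n /2⌋ + ⌊ n /2⌋ ≤ n
⌊n/2⌋+⌊n/2⌋≤n n = ≤-trans (+-monoʳ-≤ ⌊ n /2⌋ (⌊n/2⌋≤⌈n/2⌉ n)) (≤-reflexive (⌊n/2⌋+⌈n/2⌉≡n n))

⌈n/2⌉+⌈n/2⌉≤1+n : ∀ n → ⌈ n /2⌉ + ⌈ n /2⌉ ≤ suc n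
⌈n/2⌉+⌈n/2⌉≤1+n n = ≤-trans (+-monoˡ-≤ ⌈ n /2⌉ (⌈n/2⌉≤1+⌊n/2⌋ n)) (s≤s (≤-reflexive (⌊n/2⌋+⌈n/2⌉≡n n)))

count-Close : ∀ {n} (p q : Fin n → Bool) → Close (# p) (# q) → Close (count p) (count q)
count-Close p q = subst₂ Close (sym (count≡# p)) (sym (count≡# q))

halves⇒extremal : ∀ {n} (G : Digraph n) ε {X Y : Fin n → Bool} →
  # X ≡ ⌊ n /2⌋ → # Y ≡ ⌈ n /2⌉ → ⟦ e G X Y ⟧ <ℚ ε ℚ.* ⟦ n * n ⟧ → Extremal ε G
halves⇒extremal {n} G ε {X} {Y} #X #Y few =
  f , count-Close (isA ∘ f) (isB ∘ f) close-AB , count-Close (isS ∘ f) (isT ∘ f) close-ST ,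
      subst (λ m → ⟦ m ⟧ <ℚ ε ℚ.* ⟦ n * n ⟧) (e-cong G (sym ∘ A∨S≡X) (sym ∘ A∨T≡Y)) few
  where
  f : Fin n → Part
  f v = label (X v) (Y v)
  A∨S≡X : ∀ v → isA (f v) ∨ isS (f v) ≡ X v
  A∨S≡X v = proj₁ (proj₂ (proj₂ (proj₂ (label-parts (X v) (Y v)))))
  A∨T≡Y : ∀ v → isA (f v) ∨ isT (f v) ≡ Y v
  A∨T≡Y v = proj₂ (proj₂ (proj₂ (proj₂ (label-parts (X v) (Y v)))))
  s a t b : ℕ
  s = # (isS ∘ f)
  a = # (isA ∘ f)
  t = # (isT ∘ f)
  b = # (isB ∘ f)
  s+a≡⌊n/2⌋ : s + a ≡ ⌊ n /2⌋
  s+a≡⌊n/2⌋ = trans (#-partition (λ v → proj₁ (label-parts (X v) (Y v)))) #X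
  t+a≡⌈n/2⌉ : t + a ≡ ⌈ n /2⌉
  t+a≡⌈n/2⌉ = trans (#-partition (λ v → proj₁ (proj₂ (label-parts (X v) (Y v))))) #Y
  b+t≡⌈n/2⌉ : b + t ≡ ⌈ n /2⌉
  b+t≡⌈n/2⌉ = begin
    b + t            ≡⟨ #-partition (λ v → proj₁ (proj₂ (proj₂ (label-parts (X v) (Y v))))) ⟩
    # (not ∘ X)      ≡⟨ #not≡n∸# X ⟩
    n ∸ # X          ≡⟨ cong (n ∸_) #X ⟩
    n ∸ ⌊ n /2⌋      ≡⟨ n∸⌊n/2⌋≡⌈n/2⌉ n ⟩
    ⌈ n /2⌉          ∎
    where open ≡-Reasoning
  close-AB : Close a b
  close-AB rewrite +-cancelˡ-≡ t a b (trans t+a≡⌈n/2⌉ (trans (sym b+t≡⌈n/2⌉) (+-comm b t))) =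
    n≤1+n b , n≤1+n b
  close-ST : Close s t
  close-ST = m≤n⇒m≤1+n (+-cancelʳ-≤ a s t s+a≤t+a) , +-cancelʳ-≤ a t (suc s) t+a≤1+s+a
    where
    s+a≤t+a : s + a ≤ t + a
    s+a≤t+a = subst₂ _≤_ (sym s+a≡⌊n/2⌋) (sym t+a≡⌈n/2⌉) (⌊n/2⌋≤⌈n/2⌉ n)
    t+a≤1+s+a : t + a ≤ suc s + a
    t+a≤1+s+a = subst₂ _≤_ (sym t+a≡⌈n/2⌉) (cong suc (sym s+a≡⌊n/2⌋)) (⌈n/2⌉≤1+⌊n/2⌋ n)

-- In-degrees from a vertex set

module _ {n} (G : Digraph n) (σ : Fin n → Bool) where

  indegIn : Fin n → ℕ
  indegIn w = # (λ u → σ u ∧ adj G u w)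

  indegIn≤#σ : ∀ w → indegIn w ≤ # σ
  indegIn≤#σ w = ∑-mono-≤ (λ u → χ-∧ (σ u) (adj G u w))
    where
    χ-∧ : ∀ a b → χ (a ∧ b) ≤ χ a
    χ-∧ true  b = χ≤1 b
    χ-∧ false b = z≤n

  indeg+#σ≤indegIn+n : ∀ w → indeg G w + # σ ≤ indegIn w + n
  indeg+#σ≤indegIn+n w = begin
    indeg G w + # σ                                 ≡⟨ cong (_+ # σ) (count≡# (λ u → adj G u w)) ⟩
    # (λ u → adj G u w) + # σ                       ≡⟨ sym (∑-distrib-+ (λ u → χ (adj G u w)) (χ ∘ σ)) ⟩
    ∑[ u < n ] (χ (adj G u w) + χ (σ u))            ≤⟨ ∑-mono-≤ (λ u → χ-+ (σ u) (adj G u w)) ⟩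
    ∑[ u < n ] (χ (σ u ∧ adj G u w) + 1)            ≡⟨ ∑-distrib-+ (λ u → χ (σ u ∧ adj G u w)) (λ _ → 1) ⟩
    indegIn w + ∑[ u < n ] 1                        ≡⟨ cong (indegIn w +_) (trans (∑-const n 1) (*-identityʳ n)) ⟩
    indegIn w + n                                   ∎
    where
    open ≤-Reasoning
    χ-+ : ∀ a b → χ b + χ a ≤ χ (a ∧ b) + 1
    χ-+ true  true  = ≤-refl
    χ-+ true  false = ≤-refl
    χ-+ false true  = ≤-refl
    χ-+ false false = z≤n

  #σ*n≤2∑indegIn : MinSemiDegreeAtLeastHalf G → # σ * n ≤ 2 * ∑[ w < n ] indegIn w
  #σ*n≤2∑indegIn δ⁰ = begin
    # σ * n                                             ≡⟨ *-distribʳ-sum n (χ ∘ σ) ⟩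
    ∑[ u < n ] (χ (σ u) * n)                            ≤⟨ ∑-mono-≤ out-half ⟩
    ∑[ u < n ] (2 * ∑[ w < n ] χ (σ u ∧ adj G u w))
      ≡⟨ sym (*-distribˡ-sum 2 (λ u → ∑[ w < n ] χ (σ u ∧ adj G u w))) ⟩
    2 * ∑[ u < n ] ∑[ w < n ] χ (σ u ∧ adj G u w)       ≡⟨ cong (2 *_) (∑-comm (λ u w → χ (σ u ∧ adj G u w))) ⟩
    2 * ∑[ w < n ] indegIn w                            ∎
    where
    open ≤-Reasoning
    out-half : ∀ u → χ (σ u) * n ≤ 2 * ∑[ w < n ] χ (σ u ∧ adj G u w)
    out-half u with σ u
    ... | false = z≤n
    ... | true  = subst₂ (λ a b → a ≤ 2 * b) (sym (+-identityʳ n)) (count≡# (adj G u)) (proj₁ (δ⁰ u))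

  module _ (p q : ℕ) where

    RN : Fin n → Bool
    RN w = isYes (p * n ≤? q * indegIn w)

    RN-true : ∀ {w} → p * n ≤ q * indegIn w → RN w ≡ true
    RN-true {w} pn≤ = trans (isYes≗does (p * n ≤? q * indegIn w)) (dec-true (p * n ≤? q * indegIn w) pn≤)

    RN-false : ∀ {w} → RN w ≡ false → q * indegIn w < p * n
    RN-false {w} RNw with p * n ≤? q * indegIn w
    RN-false () | yes _
    ...         | no pn≰ = ≰⇒> pn≰

    q*∑indegIn≤ : q * ∑[ w < n ] indegIn w ≤ # RN * (q * # σ) + n * (p * n)
    q*∑indegIn≤ = begin
      q * ∑[ w < n ] indegIn w                                ≡⟨ *-distribˡ-sum q indegIn ⟩
      ∑[ w < n ] (q * indegIn w)                              ≤⟨ ∑-mono-≤ bound ⟩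
      ∑[ w < n ] (χ (RN w) * (q * # σ) + p * n)
        ≡⟨ ∑-distrib-+ (λ w → χ (RN w) * (q * # σ)) (λ _ → p * n) ⟩
      ∑[ w < n ] (χ (RN w) * (q * # σ)) + ∑[ w < n ] (p * n)
        ≡⟨ cong₂ _+_ (sym (*-distribʳ-sum (q * # σ) (χ ∘ RN))) (∑-const n (p * n)) ⟩
      # RN * (q * # σ) + n * (p * n)                          ∎
      where
      open ≤-Reasoning
      bound : ∀ w → q * indegIn w ≤ χ (RN w) * (q * # σ) + p * n
      bound w with RN w in RNw
      ... | true  = ≤-trans (*-monoʳ-≤ q (indegIn≤#σ w))
                      (≤-trans (≤-reflexive (sym (+-identityʳ (q * # σ)))) (m≤m+n (1 * (q * # σ)) (p * n)))
      ... | false = <⇒≤ (RN-false RNw)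

    q*e[σ,∁RN]≤ : q * e G σ (not ∘ RN) ≤ n * (p * n)
    q*e[σ,∁RN]≤ = begin
      q * e G σ (not ∘ RN)                         ≡⟨ cong (q *_) (trans (e≡∑∑ G σ (not ∘ RN)) (∑-comm E)) ⟩
      q * ∑[ y < n ] ∑[ x < n ] E x y              ≡⟨ *-distribˡ-sum q (λ y → ∑[ x < n ] E x y) ⟩
      ∑[ y < n ] (q * ∑[ x < n ] E x y)            ≤⟨ ∑-≤-const (p * n) bound ⟩
      n * (p * n)                                  ∎
      where
      open ≤-Reasoning
      E : Fin n → Fin n → ℕ
      E x y = χ (σ x ∧ (not (RN y) ∧ adj G x y))
      bound : ∀ y → q * ∑[ x < n ] E x y ≤ p * n
      bound y with RN y in RNy
      ... | true  = subst (_≤ p * n) (cong (q *_) (sym (trans (#-cong (λ x → ∧-zeroʳ (σ x))) (#-empty {n}))))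
                      (subst (_≤ p * n) (sym (*-zeroʳ q)) z≤n)
      ... | false = <⇒≤ (RN-false RNy)

-- Arithmetic of the three cases

robust-if-large : ∀ {n s p q d i} → n ≤ 2 * d → d + s ≤ i + n →
  q * n + 2 * (p * n) ≤ 2 * (q * s) → p * n ≤ q * i
robust-if-large {n} {s} {p} {q} {d} {i} n≤2d d+s≤i+n large =
  *-cancelˡ-≤ 2 (+-cancelʳ-≤ (q * n + q * n) (2 * (p * n)) (2 * (q * i)) (begin
    2 * (p * n) + (q * n + q * n)  ≡⟨ solve (n ∷ p ∷ q ∷ []) ⟩
    q * n + (q * n + 2 * (p * n))  ≤⟨ +-mono-≤ (*-monoʳ-≤ q n≤2d) large ⟩
    q * (2 * d) + 2 * (q * s)      ≡⟨ solve (s ∷ q ∷ d ∷ []) ⟩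
    2 * (q * (d + s))              ≤⟨ *-monoʳ-≤ 2 (*-monoʳ-≤ q d+s≤i+n) ⟩
    2 * (q * (i + n))              ≡⟨ solve (n ∷ q ∷ i ∷ []) ⟩
    2 * (q * i) + (q * n + q * n)  ∎))
  where open ≤-Reasoning

¬large-in-window : ∀ {n s p q M} .{{_ : NonZero M}} →
  q * n < q * s + p * n → M * s + n ≤ M * n → M * p ≤ q → ⊥
¬large-in-window {n} {s} {p} {q} {M} qn<qs+pn window Mp≤q = <⇒≱ qn<qs+pn (*-cancelˡ-≤ M (begin
  M * (q * s + p * n)    ≡⟨ solve (n ∷ s ∷ p ∷ q ∷ M ∷ []) ⟩
  q * (M * s) + M * p * n ≤⟨ +-monoʳ-≤ (q * (M * s)) (*-monoˡ-≤ n Mp≤q) ⟩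
  q * (M * s) + q * n    ≡⟨ solve (n ∷ s ∷ q ∷ M ∷ []) ⟩
  q * (M * s + n)        ≤⟨ *-monoʳ-≤ q window ⟩
  q * (M * n)            ≡⟨ solve (n ∷ q ∷ M ∷ []) ⟩
  M * (q * n)            ∎))
  where open ≤-Reasoning

double-count-bound : ∀ {n s r p q T} → s * n ≤ 2 * T → q * T ≤ r * (q * s) + n * (p * n) →
  q * r < q * s + p * n → s ≤ n → q * (s * n) ≤ 2 * (q * (s * s)) + 4 * (p * (n * n))
double-count-bound {n} {s} {r} {p} {q} {T} sn≤2T qT≤ qr< s≤n = begin
  q * (s * n)                                   ≤⟨ *-monoʳ-≤ q sn≤2T ⟩
  q * (2 * T)                                   ≡⟨ solve (q ∷ T ∷ []) ⟩
  2 * (q * T)                                   ≤⟨ *-monoʳ-≤ 2 qT≤ ⟩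
  2 * (r * (q * s) + n * (p * n))               ≡⟨ solve (n ∷ s ∷ r ∷ p ∷ q ∷ []) ⟩
  2 * ((q * r) * s + p * (n * n))               ≤⟨ *-monoʳ-≤ 2 (+-monoˡ-≤ (p * (n * n)) (*-monoˡ-≤ s (<⇒≤ qr<))) ⟩
  2 * ((q * s + p * n) * s + p * (n * n))       ≡⟨ solve (n ∷ s ∷ p ∷ q ∷ []) ⟩
  2 * (q * (s * s)) + 2 * (p * n * s) + 2 * (p * (n * n))
    ≤⟨ +-monoˡ-≤ (2 * (p * (n * n))) (+-monoʳ-≤ (2 * (q * (s * s))) (*-monoʳ-≤ 2 (*-monoʳ-≤ (p * n) s≤n))) ⟩
  2 * (q * (s * s)) + 2 * (p * n * n) + 2 * (p * (n * n)) ≡⟨ solve (n ∷ s ∷ p ∷ q ∷ []) ⟩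
  2 * (q * (s * s)) + 4 * (p * (n * n))         ∎
  where open ≤-Reasoning

¬far-below-half : ∀ {n s p q M} .{{_ : NonZero q}} .{{_ : NonZero n}} →
  q * (s * n) ≤ 2 * (q * (s * s)) + 4 * (p * (n * n)) → n + 8 * M * s ≤ 4 * M * n →
  n < M * s → 16 * (M * M) * p ≤ q → ⊥
¬far-below-half {n} {s} {p} {q} {M} count-bound far n<Ms ν≤ν₀ = <-irrefl refl (begin-strict
  q * n * n                    <⟨ *-monoʳ-< (q * n) {{m*n≢0 q n}} n<Ms ⟩
  q * n * (M * s)              ≡⟨ solve (n ∷ s ∷ q ∷ M ∷ []) ⟩
  M * (q * (s * n))            ≤⟨ *-monoʳ-≤ M qsn≤16Mpnn ⟩
  M * (16 * M * (p * (n * n))) ≡⟨ solve (n ∷ p ∷ M ∷ []) ⟩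
  16 * (M * M) * p * (n * n)   ≤⟨ *-monoˡ-≤ (n * n) ν≤ν₀ ⟩
  q * (n * n)                  ≡⟨ sym (*-assoc q n n) ⟩
  q * n * n                    ∎)
  where
  open ≤-Reasoning
  qsn≤16Mpnn : q * (s * n) ≤ 16 * M * (p * (n * n))
  qsn≤16Mpnn = +-cancelʳ-≤ (8 * M * (q * (s * s))) _ _ (begin
    q * (s * n) + 8 * M * (q * (s * s))                ≡⟨ solve (n ∷ s ∷ q ∷ M ∷ []) ⟩
    q * s * (n + 8 * M * s)                            ≤⟨ *-monoʳ-≤ (q * s) far ⟩
    q * s * (4 * M * n)                                ≡⟨ solve (n ∷ s ∷ q ∷ M ∷ []) ⟩
    4 * M * (q * (s * n))                              ≤⟨ *-monoʳ-≤ (4 * M) count-bound ⟩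
    4 * M * (2 * (q * (s * s)) + 4 * (p * (n * n)))    ≡⟨ solve (n ∷ s ∷ p ∷ q ∷ M ∷ []) ⟩
    16 * M * (p * (n * n)) + 8 * M * (q * (s * s))     ∎)

near-half-excess : ∀ {n s h a M} .{{_ : NonZero n}} → a ≡ 0 ⊎ a + s ≡ h → h + h ≤ n →
  4 * M * n < n + 8 * M * s → 8 * M * a < n
near-half-excess {n} {M = M} (inj₁ refl) _ _ = subst (_< n) (sym (*-zeroʳ (8 * M))) (>-nonZero⁻¹ n)
near-half-excess {n} {s} {h} {a} {M} (inj₂ a+s≡h) h+h≤n near =
  +-cancelʳ-< (8 * M * s) (8 * M * a) n (begin-strict
    8 * M * a + 8 * M * s    ≡⟨ solve (s ∷ a ∷ M ∷ []) ⟩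
    4 * M * ((a + s) + (a + s)) ≡⟨ cong (λ x → 4 * M * (x + x)) a+s≡h ⟩
    4 * M * (h + h)          ≤⟨ *-monoʳ-≤ (4 * M) h+h≤n ⟩
    4 * M * n                <⟨ near ⟩
    n + 8 * M * s            ∎)
  where open ≤-Reasoning

near-half-deficit : ∀ {n s r w h a p q} .{{_ : NonZero q}} → a ≡ 0 ⊎ a + w ≡ h → w + r ≡ n →
  h + h ≤ suc n → 2 * (q * s) < q * n + 2 * (p * n) → q * r < q * s + p * n →
  q * (2 * a) < q + 4 * (p * n)
near-half-deficit {n} {p = p} {q} (inj₁ refl) _ _ _ _ =
  subst (_< q + 4 * (p * n)) (sym (*-zeroʳ q)) (<-≤-trans (>-nonZero⁻¹ q) (m≤m+n q (4 * (p * n))))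
near-half-deficit {n} {s} {r} {w} {h} {a} {p} {q} (inj₂ a+w≡h) w+r≡n h+h≤1+n not-large qr< =
  +-cancelʳ-< (2 * (q * n)) (q * (2 * a)) (q + 4 * (p * n)) (begin-strict
    q * (2 * a) + 2 * (q * n)                 ≡⟨ solve (n ∷ a ∷ q ∷ []) ⟩
    2 * (q * (a + n))                         ≡⟨ cong (λ x → 2 * (q * x)) a+n≡h+r ⟩
    2 * (q * (h + r))                         ≡⟨ solve (r ∷ h ∷ q ∷ []) ⟩
    q * (h + h) + 2 * (q * r)                 ≤⟨ +-mono-≤ (*-monoʳ-≤ q h+h≤1+n) (*-monoʳ-≤ 2 (<⇒≤ qr<)) ⟩
    q * suc n + 2 * (q * s + p * n)           ≡⟨ solve (n ∷ s ∷ p ∷ q ∷ []) ⟩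
    q + q * n + 2 * (q * s) + 2 * (p * n)     <⟨ +-monoˡ-< (2 * (p * n)) (+-monoʳ-< (q + q * n) not-large) ⟩
    q + q * n + (q * n + 2 * (p * n)) + 2 * (p * n) ≡⟨ solve (n ∷ p ∷ q ∷ []) ⟩
    q + 4 * (p * n) + 2 * (q * n)             ∎)
  where
  open ≤-Reasoning
  a+n≡h+r : a + n ≡ h + r
  a+n≡h+r = begin-equality
    a + n        ≡⟨ cong (a +_) (sym w+r≡n) ⟩
    a + (w + r)  ≡⟨ sym (+-assoc a w r) ⟩
    a + w + r    ≡⟨ cong (_+ r) a+w≡h ⟩
    h + r        ∎

16M*E₀≤n*n : ∀ {n p q M E₀} .{{_ : NonZero q}} .{{_ : NonZero M}} →
  q * E₀ ≤ n * (p * n) → 16 * (M * M) * p ≤ q → 16 * M * E₀ ≤ n * n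
16M*E₀≤n*n {n} {p} {q} {M} {E₀} qE₀≤ ν≤ν₀ = begin
  16 * M * E₀         ≤⟨ *-monoˡ-≤ E₀ (*-monoʳ-≤ 16 (m≤m*n M M)) ⟩
  16 * (M * M) * E₀   ≤⟨ *-cancelˡ-≤ q (begin
      q * (16 * (M * M) * E₀)     ≡⟨ solve (q ∷ M ∷ E₀ ∷ []) ⟩
      16 * (M * M) * (q * E₀)     ≤⟨ *-monoʳ-≤ (16 * (M * M)) qE₀≤ ⟩
      16 * (M * M) * (n * (p * n)) ≡⟨ solve (n ∷ p ∷ M ∷ []) ⟩
      16 * (M * M) * p * (n * n)  ≤⟨ *-monoˡ-≤ (n * n) ν≤ν₀ ⟩
      q * (n * n)                 ∎) ⟩
  n * n               ∎
  where open ≤-Reasoning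

16M*na₁≤2nn : ∀ {n a M} → 8 * M * a < n → 16 * M * (n * a) ≤ 2 * (n * n)
16M*na₁≤2nn {n} {a} {M} 8Ma<n = begin
  16 * M * (n * a)    ≡⟨ solve (n ∷ a ∷ M ∷ []) ⟩
  2 * (n * (8 * M * a)) ≤⟨ *-monoʳ-≤ 2 (*-monoʳ-≤ n (<⇒≤ 8Ma<n)) ⟩
  2 * (n * n)         ∎
  where open ≤-Reasoning

16M*na₂<3nn : ∀ {n a p q M} .{{_ : NonZero q}} .{{_ : NonZero M}} .{{_ : NonZero n}} →
  q * (2 * a) < q + 4 * (p * n) → 16 * (M * M) * p ≤ q → 8 * M ≤ n → 16 * M * (n * a) < 3 * (n * n)
16M*na₂<3nn {n} {a} {p} {q} {M} deficit ν≤ν₀ 8M≤n = *-cancelˡ-< q _ _ (begin-strict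
  q * (16 * M * (n * a))               ≡⟨ solve (n ∷ a ∷ q ∷ M ∷ []) ⟩
  8 * M * n * (q * (2 * a))            <⟨ *-monoʳ-< (8 * M * n) {{m*n≢0 (8 * M) n {{m*n≢0 8 M}}}} deficit ⟩
  8 * M * n * (q + 4 * (p * n))        ≡⟨ solve (n ∷ p ∷ q ∷ M ∷ []) ⟩
  q * n * (8 * M) + 2 * (16 * M * p) * (n * n)
    ≤⟨ +-mono-≤ (*-monoʳ-≤ (q * n) 8M≤n) (*-monoˡ-≤ (n * n) (*-monoʳ-≤ 2 16Mp≤q)) ⟩
  q * n * n + 2 * q * (n * n)          ≡⟨ solve (n ∷ q ∷ []) ⟩
  q * (3 * (n * n))                    ∎)
  where
  open ≤-Reasoning
  16Mp≤q : 16 * M * p ≤ q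
  16Mp≤q = ≤-trans (*-monoˡ-≤ p (*-monoʳ-≤ 16 (m≤m*n M M))) ν≤ν₀

few-edges : ∀ {n p q M e E₀ a₁ a₂} .{{_ : NonZero q}} .{{_ : NonZero M}} .{{_ : NonZero n}} →
  e ≤ E₀ + n * a₁ + n * a₂ → q * E₀ ≤ n * (p * n) → 16 * (M * M) * p ≤ q → 8 * M ≤ n →
  8 * M * a₁ < n → q * (2 * a₂) < q + 4 * (p * n) → M * e < n * n
few-edges {n} {p} {q} {M} {e} {E₀} {a₁} {a₂} e≤ qE₀≤ ν≤ν₀ 8M≤n excess deficit =
  *-cancelˡ-< 16 (M * e) (n * n) (begin-strict
  16 * (M * e)                                          ≤⟨ *-monoʳ-≤ 16 (*-monoʳ-≤ M e≤) ⟩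
  16 * (M * (E₀ + n * a₁ + n * a₂))                     ≡⟨ solve (n ∷ M ∷ E₀ ∷ a₁ ∷ a₂ ∷ []) ⟩
  16 * M * E₀ + 16 * M * (n * a₁) + 16 * M * (n * a₂)
    <⟨ +-mono-≤-< (+-mono-≤ (16M*E₀≤n*n {n} {M = M} qE₀≤ ν≤ν₀) (16M*na₁≤2nn {n} {a₁} {M} excess))
                  (16M*na₂<3nn deficit ν≤ν₀ 8M≤n) ⟩
  n * n + 2 * (n * n) + 3 * (n * n)                     ≡⟨ solve (n ∷ []) ⟩
  6 * (n * n)                                           ≤⟨ *-monoˡ-≤ (n * n) (m≤m+n 6 10) ⟩
  16 * (n * n)                                          ∎)
  where open ≤-Reasoning

window-scale : ∀ {n s a D} E .{{_ : NonZero a}} .{{_ : NonZero E}} → a * n < D * s →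
  D * s < (D ∸ a) * n → a ≤ D → n < D * E * s × D * E * s + n ≤ D * E * n
window-scale {n} {s} {a} {D} E an<Ds Ds<[D-a]n a≤D = lower , upper
  where
  open ≤-Reasoning
  lower : n < D * E * s
  lower = begin-strict
    n              ≤⟨ m≤n*m n a ⟩
    a * n          <⟨ an<Ds ⟩
    D * s          ≤⟨ m≤m*n (D * s) E ⟩
    D * s * E      ≡⟨ solve (s ∷ D ∷ E ∷ []) ⟩
    D * E * s      ∎
  Ds+n≤Dn : D * s + n ≤ D * n
  Ds+n≤Dn = begin
    D * s + n            ≤⟨ +-mono-≤ (<⇒≤ Ds<[D-a]n) (m≤n*m n a) ⟩
    (D ∸ a) * n + a * n  ≡⟨ sym (*-distribʳ-+ n (D ∸ a) a) ⟩
    (D ∸ a + a) * n      ≡⟨ cong (_* n) (m∸n+n≡m a≤D) ⟩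
    D * n                ∎
  upper : D * E * s + n ≤ D * E * n
  upper = begin
    D * E * s + n        ≤⟨ +-monoʳ-≤ (D * E * s) (m≤n*m n E) ⟩
    D * E * s + E * n    ≡⟨ solve (n ∷ s ∷ D ∷ E ∷ []) ⟩
    E * (D * s + n)      ≤⟨ *-monoʳ-≤ E Ds+n≤Dn ⟩
    E * (D * n)          ≡⟨ solve (n ∷ D ∷ E ∷ []) ⟩
    D * E * n            ∎

-- A non-expanding set in the window forces two halves with few edges between them.
-- Here ν = p/q, the window is n/M < |σ| ≤ n - n/M, and RN p q is the ν-robust outneighbourhood of σ.

module NonExpanding {n} (G : Digraph n) (δ⁰ : MinSemiDegreeAtLeastHalf G) (σ : Fin n → Bool)
  {p q M} .{{_ : NonZero q}} .{{_ : NonZero M}}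
  (ν≤ν₀ : 16 * (M * M) * p ≤ q) (8M≤n : 8 * M ≤ n)
  (n<Ms : n < M * # σ) (Ms+n≤Mn : M * # σ + n ≤ M * n)
  (nonexpanding : q * # (RN G σ p q) < q * # σ + p * n) where

  private
    R : Fin n → Bool
    R = RN G σ p q

    instance
      n≢0 : NonZero n
      n≢0 = >-nonZero (<-≤-trans (>-nonZero⁻¹ (8 * M) {{m*n≢0 8 M}}) 8M≤n)

  ¬large : ¬ (q * n + 2 * (p * n) ≤ 2 * (q * # σ))
  ¬large large = ¬large-in-window (subst (λ r → q * r < q * # σ + p * n) #R≡n nonexpanding) Ms+n≤Mn Mp≤q
    where
    #R≡n : # R ≡ n
    #R≡n = begin
      # R                ≡⟨ #-cong (λ w → RN-true G σ p q (robust-if-large {n} {# σ} {p} {q}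
                                (proj₂ (δ⁰ w)) (indeg+#σ≤indegIn+n G σ w) large)) ⟩
      ∑[ w < n ] 1       ≡⟨ ∑-const n 1 ⟩
      n * 1              ≡⟨ *-identityʳ n ⟩
      n                  ∎
      where open ≡-Reasoning
    Mp≤q : M * p ≤ q
    Mp≤q = ≤-trans (*-monoˡ-≤ p (≤-trans (m≤m*n M M) (m≤n*m (M * M) 16))) ν≤ν₀

  ¬far-below : ¬ (n + 8 * M * # σ ≤ 4 * M * n)
  ¬far-below far = ¬far-below-half {n} {# σ} {p} {q} {M} double-count far n<Ms ν≤ν₀
    where
    double-count : q * (# σ * n) ≤ 2 * (q * (# σ * # σ)) + 4 * (p * (n * n))
    double-count = double-count-bound {n} {# σ} {# R} {p} {q}
      (#σ*n≤2∑indegIn G σ δ⁰) (q*∑indegIn≤ G σ p q) nonexpanding (#≤n σ)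

  near-half⇒halves : 2 * (q * # σ) < q * n + 2 * (p * n) → 4 * M * n < n + 8 * M * # σ →
    ∃₂ λ X Y → # X ≡ ⌊ n /2⌋ × # Y ≡ ⌈ n /2⌉ × M * e G X Y < n * n
  near-half⇒halves not-large near
    with ∃-nested-of-size σ ⌊ n /2⌋ (⌊n/2⌋≤n n) | ∃-nested-of-size (not ∘ R) ⌈ n /2⌉ (⌈n/2⌉≤n n)
  ... | X , #X , X~σ | Y , #Y , Y~∁R = X , Y , #X , #Y ,
    few-edges {p = p} (e-≤-perturb G X Y σ (not ∘ R)) (q*e[σ,∁RN]≤ G σ p q) ν≤ν₀ 8M≤n excess deficit
    where
    excess : 8 * M * # (X ∖ σ) < n
    excess = near-half-excess {M = M} (nested⇒#∖ X~σ) (subst (λ h → h + h ≤ n) (sym #X) (⌊n/2⌋+⌊n/2⌋≤n n)) near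
    deficit : q * (2 * # (Y ∖ (not ∘ R))) < q + 4 * (p * n)
    deficit = near-half-deficit {p = p} (nested⇒#∖ Y~∁R) (#-complement R)
      (subst (λ h → h + h ≤ suc n) (sym #Y) (⌈n/2⌉+⌈n/2⌉≤1+n n)) not-large nonexpanding

  nonexpanding⇒halves : ∃₂ λ X Y → # X ≡ ⌊ n /2⌋ × # Y ≡ ⌈ n /2⌉ × M * e G X Y < n * n
  nonexpanding⇒halves = near-half⇒halves (≰⇒> ¬large) (≰⇒> ¬far-below)

-- Rational parameters as fractions

-- x = a / (1 + d): the second field of mkℚᵘ is the denominator minus one.
Fraction : ℚ → ℕ → ℕ → Set
Fraction x a d = toℚᵘ x ≃ᵘ mkℚᵘ (ℤ.+ a) d

fromℚᵘ-fraction : ∀ a d → Fraction (fromℚᵘ (mkℚᵘ (ℤ.+ a) d)) a d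
fromℚᵘ-fraction a d = ℚₚ.toℚᵘ-fromℚᵘ (mkℚᵘ (ℤ.+ a) d)

⟦⟧-fraction : ∀ k → Fraction ⟦ k ⟧ k 0
⟦⟧-fraction k = fromℚᵘ-fraction k 0

positive-fraction : ∀ x → 0ℚ <ℚ x → ∃₂ λ a d → Fraction x (suc a) d
positive-fraction (mkℚ (ℤ.+ suc a) d _) _ = a , d , ℚᵘₚ.≃-refl
positive-fraction (mkℚ (ℤ.+ zero)  d _) (ℚ.*<* (+<+ ()))
positive-fraction (mkℚ -[1+ a ]  d _) (ℚ.*<* ())

module _ {x y a b d e} (x≃a/d : Fraction x a d) (y≃b/e : Fraction y b e) where

  fraction-mono-≤ : x ≤ℚ y → a * suc e ≤ b * suc d
  fraction-mono-≤ x≤y with ℚᵘₚ.≤-respˡ-≃ x≃a/d (ℚᵘₚ.≤-respʳ-≃ y≃b/e (ℚₚ.toℚᵘ-mono-≤ x≤y))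
  ... | *≤* ad≤bc = ℤₚ.drop‿+≤+ (subst₂ ℤ._≤_ (sym (ℤₚ.pos-* a (suc e))) (sym (ℤₚ.pos-* b (suc d))) ad≤bc)

  fraction-mono-< : x <ℚ y → a * suc e < b * suc d
  fraction-mono-< x<y with ℚᵘₚ.<-respˡ-≃ x≃a/d (ℚᵘₚ.<-respʳ-≃ y≃b/e (ℚₚ.toℚᵘ-mono-< x<y))
  ... | *<* ad<bc = ℤₚ.drop‿+<+ (subst₂ ℤ._<_ (sym (ℤₚ.pos-* a (suc e))) (sym (ℤₚ.pos-* b (suc d))) ad<bc)

  fraction-cancel-≤ : a * suc e ≤ b * suc d → x ≤ℚ y
  fraction-cancel-≤ ad≤bc = ℚₚ.toℚᵘ-cancel-≤ (ℚᵘₚ.≤-respˡ-≃ (ℚᵘₚ.≃-sym x≃a/d) (ℚᵘₚ.≤-respʳ-≃ (ℚᵘₚ.≃-sym y≃b/e)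
    (*≤* (subst₂ ℤ._≤_ (ℤₚ.pos-* a (suc e)) (ℤₚ.pos-* b (suc d)) (+≤+ ad≤bc)))))

  fraction-cancel-< : a * suc e < b * suc d → x <ℚ y
  fraction-cancel-< ad<bc = ℚₚ.toℚᵘ-cancel-< (ℚᵘₚ.<-respˡ-≃ (ℚᵘₚ.≃-sym x≃a/d) (ℚᵘₚ.<-respʳ-≃ (ℚᵘₚ.≃-sym y≃b/e)
    (*<* (subst₂ ℤ._<_ (ℤₚ.pos-* a (suc e)) (ℤₚ.pos-* b (suc d)) (+<+ ad<bc)))))

module _ {x a d} (x≃a/d : Fraction x a d) where

  *⟦⟧-fraction : ∀ n → Fraction (x ℚ.* ⟦ n ⟧) (a * n) d
  *⟦⟧-fraction n = ℚᵘₚ.≃-trans (ℚₚ.toℚᵘ-homo-* x ⟦ n ⟧) (ℚᵘₚ.≃-trans (ℚᵘₚ.*-cong x≃a/d (⟦⟧-fraction n))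
    (*≡* (cong₂ ℤ._*_ (sym (ℤₚ.pos-* a n)) (cong (λ m → ℤ.+ suc m) (sym (*-identityʳ d))))))

  ⟦⟧+-fraction : ∀ s → Fraction (⟦ s ⟧ ℚ.+ x) (suc d * s + a) d
  ⟦⟧+-fraction s = ℚᵘₚ.≃-trans (ℚₚ.toℚᵘ-homo-+ ⟦ s ⟧ x) (ℚᵘₚ.≃-trans (ℚᵘₚ.+-cong (⟦⟧-fraction s) x≃a/d)
    (*≡* (cong₂ ℤ._*_ numerator (cong (λ m → ℤ.+ suc m) (sym (+-identityʳ d))))))
    where
    numerator : ℤ.+ s ℤ.* ℤ.+ suc d ℤ.+ ℤ.+ a ℤ.* ℤ.+ 1 ≡ ℤ.+ (suc d * s + a)
    numerator = begin
      ℤ.+ s ℤ.* ℤ.+ suc d ℤ.+ ℤ.+ a ℤ.* ℤ.+ 1   ≡⟨ cong₂ ℤ._+_ (sym (ℤₚ.pos-* s (suc d))) (ℤₚ.*-identityʳ (ℤ.+ a)) ⟩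
      ℤ.+ (s * suc d) ℤ.+ ℤ.+ a           ≡⟨ sym (ℤₚ.pos-+ (s * suc d) a) ⟩
      ℤ.+ (s * suc d + a)               ≡⟨ cong (λ m → ℤ.+ (m + a)) (*-comm s (suc d)) ⟩
      ℤ.+ (suc d * s + a)               ∎
      where open ≡-Reasoning

  1-fraction : a ≤ suc d → Fraction (1ℚ ℚ.- x) (suc d ∸ a) d
  1-fraction a≤1+d = ℚᵘₚ.≃-trans (ℚₚ.toℚᵘ-homo-+ 1ℚ (ℚ.- x))
    (ℚᵘₚ.≃-trans (ℚᵘₚ.+-cong (fromℚᵘ-fraction 1 0) (ℚᵘₚ.≃-trans (ℚₚ.toℚᵘ-homo‿- x) (ℚᵘₚ.-‿cong x≃a/d)))
      (*≡* (cong₂ ℤ._*_ numerator (cong (λ m → ℤ.+ suc m) (sym (+-identityʳ d))))))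
    where
    numerator : ℤ.+ 1 ℤ.* ℤ.+ suc d ℤ.+ ℤ.- ℤ.+ a ℤ.* ℤ.+ 1 ≡ ℤ.+ (suc d ∸ a)
    numerator = begin
      ℤ.+ 1 ℤ.* ℤ.+ suc d ℤ.+ ℤ.- ℤ.+ a ℤ.* ℤ.+ 1   ≡⟨ cong₂ ℤ._+_ (ℤₚ.*-identityˡ (ℤ.+ suc d)) (ℤₚ.*-identityʳ (ℤ.- ℤ.+ a)) ⟩
      ℤ.+ suc d ℤ.+ ℤ.- ℤ.+ a                 ≡⟨ ℤₚ.m-n≡m⊖n (suc d) a ⟩
      suc d ℤ.⊖ a                         ≡⟨ ℤₚ.⊖-≥ a≤1+d ⟩
      ℤ.+ (suc d ∸ a)                       ∎
      where open ≡-Reasoning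

  fraction<⟦⟧ : ∀ {k} → x <ℚ ⟦ k ⟧ → a < suc d * k
  fraction<⟦⟧ {k} x<k = subst₂ _<_ (*-identityʳ a) (*-comm k (suc d)) (fraction-mono-< x≃a/d (⟦⟧-fraction k) x<k)

  ⟦⟧<fraction : ∀ {k} → ⟦ k ⟧ <ℚ x → suc d * k < a
  ⟦⟧<fraction {k} k<x = subst₂ _<_ (*-comm k (suc d)) (*-identityʳ a) (fraction-mono-< (⟦⟧-fraction k) x≃a/d k<x)

  ⟦⟧<fraction⁻ : ∀ {k} → suc d * k < a → ⟦ k ⟧ <ℚ x
  ⟦⟧<fraction⁻ {k} dk<a =
    fraction-cancel-< (⟦⟧-fraction k) x≃a/d (subst₂ _<_ (*-comm (suc d) k) (sym (*-identityʳ a)) dk<a)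

  fraction≤⟦⟧ : ∀ {k} → x ≤ℚ ⟦ k ⟧ → a ≤ suc d * k
  fraction≤⟦⟧ {k} x≤k = subst₂ _≤_ (*-identityʳ a) (*-comm k (suc d)) (fraction-mono-≤ x≃a/d (⟦⟧-fraction k) x≤k)

  fraction≤⟦⟧⁻ : ∀ {k} → a ≤ suc d * k → x ≤ℚ ⟦ k ⟧
  fraction≤⟦⟧⁻ {k} a≤dk =
    fraction-cancel-≤ x≃a/d (⟦⟧-fraction k) (subst₂ _≤_ (sym (*-identityʳ a)) (*-comm (suc d) k) a≤dk)

ν₀ : ℕ → ℚ
ν₀ M = fromℚᵘ (mkℚᵘ (ℤ.+ 1) (ℕ.pred (16 * (M * M))))

positive-threshold : ∀ M → 0ℚ <ℚ ν₀ M
positive-threshold M =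
  fraction-cancel-< (fromℚᵘ-fraction 0 0) (fromℚᵘ-fraction 1 (ℕ.pred (16 * (M * M)))) (s≤s z≤n)

≤ν₀⇒16M²p≤q : ∀ {ν p d} M .{{_ : NonZero M}} → Fraction ν p d → ν ≤ℚ ν₀ M → 16 * (M * M) * p ≤ suc d
≤ν₀⇒16M²p≤q {p = p} {d} M ν≃p/d ν≤ν₀ =
  subst₂ _≤_ (trans (cong (p *_) (suc-pred K)) (*-comm p K)) (*-identityˡ (suc d))
    (fraction-mono-≤ ν≃p/d (fromℚᵘ-fraction 1 (ℕ.pred K)) ν≤ν₀)
  where
  K : ℕ
  K = 16 * (M * M)
  instance
    M²≢0 : NonZero (M * M)
    M²≢0 = m*n≢0 M M
    K≢0 : NonZero K
    K≢0 = m*n≢0 16 (M * M)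

module _ {τ a d} (τ≃ : Fraction τ (suc a) d) (τ<1 : τ <ℚ 1ℚ) where

  τ-window : ∀ {n s} E .{{_ : NonZero E}} → τ ℚ.* ⟦ n ⟧ <ℚ ⟦ s ⟧ → ⟦ s ⟧ <ℚ (1ℚ ℚ.- τ) ℚ.* ⟦ n ⟧ →
    n < suc d * E * s × suc d * E * s + n ≤ suc d * E * n
  τ-window {n} E τn<s s<[1-τ]n = window-scale E (fraction<⟦⟧ (*⟦⟧-fraction τ≃ n) τn<s)
    (⟦⟧<fraction (*⟦⟧-fraction (1-fraction τ≃ a<d) n) s<[1-τ]n) a<d
    where
    a<d : suc a ≤ suc d
    a<d = <⇒≤ (subst (suc a <_) (*-identityʳ (suc d)) (fraction<⟦⟧ τ≃ τ<1))

M*k<m⇒k<ε*m : ∀ {ε b d′ k m} → Fraction ε (suc b) d′ → ∀ D .{{_ : NonZero D}} → D * suc d′ * k < m →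
  ⟦ k ⟧ <ℚ ε ℚ.* ⟦ m ⟧
M*k<m⇒k<ε*m {b = b} {d′} {k} {m} ε≃ D Dk<m = ⟦⟧<fraction⁻ (*⟦⟧-fraction ε≃ m) (begin-strict
  suc d′ * k      ≤⟨ *-monoˡ-≤ k (m≤n*m (suc d′) D) ⟩
  D * suc d′ * k  <⟨ Dk<m ⟩
  m               ≤⟨ m≤n*m m (suc b) ⟩
  suc b * m       ∎)
  where open ≤-Reasoning

isYes-cong : ∀ {A B : Set} (a? : Dec A) (b? : Dec B) → (A → B) → (B → A) → isYes a? ≡ isYes b?
isYes-cong (yes _)  (yes _)  _   _   = refl
isYes-cong (no _)   (no _)   _   _   = refl
isYes-cong (yes a)  (no ¬b)  A⇒B _   = ⊥-elim (¬b (A⇒B a))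
isYes-cong (no ¬a)  (yes b)  _   B⇒A = ⊥-elim (¬a (B⇒A b))

∣RN⁺∣≡#RN : ∀ {n ν p d} (G : Digraph n) (S : Subset n) → Fraction ν p d →
  ∣ RN⁺ ν G S ∣ ≡ # (RN G (lookup S) p (suc d))
∣RN⁺∣≡#RN {n} {ν} {p} {d} G S ν≃p/d =
  trans (count≡# (λ w → isYes (ν ℚ.* ⟦ n ⟧ ℚₚ.≤? ⟦ inFrom G S w ⟧))) (#-cong same-threshold)
  where
  same-threshold : ∀ w → isYes (ν ℚ.* ⟦ n ⟧ ℚₚ.≤? ⟦ inFrom G S w ⟧) ≡ RN G (lookup S) p (suc d) w
  same-threshold w = isYes-cong (ν ℚ.* ⟦ n ⟧ ℚₚ.≤? ⟦ inFrom G S w ⟧) (p * n ≤? suc d * indegIn G (lookup S) w)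
    (subst (λ k → p * n ≤ suc d * k) inFrom≡ ∘ fraction≤⟦⟧ (*⟦⟧-fraction ν≃p/d n))
    (fraction≤⟦⟧⁻ (*⟦⟧-fraction ν≃p/d n) ∘ subst (λ k → p * n ≤ suc d * k) (sym inFrom≡))
    where
    inFrom≡ : inFrom G S w ≡ indegIn G (lookup S) w
    inFrom≡ = count≡# (λ u → lookup S u ∧ adj G u w)

NonExpandingSet : ∀ {n} → ℚ → ℚ → Digraph n → Subset n → Set
NonExpandingSet {n} ν τ G S =
  τ ℚ.* ⟦ n ⟧ <ℚ ⟦ ∣ S ∣ ⟧ × ⟦ ∣ S ∣ ⟧ <ℚ (1ℚ ℚ.- τ) ℚ.* ⟦ n ⟧ ×
  ⟦ ∣ RN⁺ ν G S ∣ ⟧ <ℚ ⟦ ∣ S ∣ ⟧ ℚ.+ ν ℚ.* ⟦ n ⟧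

robustOutexpander⊎nonexpanding : ∀ {n} (G : Digraph n) ν τ → RobustOutexpander ν τ G ⊎ ∃ (NonExpandingSet ν τ G)
robustOutexpander⊎nonexpanding {n} G ν τ = decide (anySubset? nonexpanding?)
  where
  nonexpanding? : ∀ S → Dec (NonExpandingSet ν τ G S)
  nonexpanding? S = (τ ℚ.* ⟦ n ⟧ ℚₚ.<? ⟦ ∣ S ∣ ⟧) ×-dec (⟦ ∣ S ∣ ⟧ ℚₚ.<? (1ℚ ℚ.- τ) ℚ.* ⟦ n ⟧)
                    ×-dec (⟦ ∣ RN⁺ ν G S ∣ ⟧ ℚₚ.<? ⟦ ∣ S ∣ ⟧ ℚ.+ ν ℚ.* ⟦ n ⟧)
  decide : Dec (∃ (NonExpandingSet ν τ G)) → RobustOutexpander ν τ G ⊎ ∃ (NonExpandingSet ν τ G)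
  decide (yes nonexpanding) = inj₂ nonexpanding
  decide (no  expanding)    =
    inj₁ λ S τn<s s<[1-τ]n → ℚₚ.≮⇒≥ (λ r<s+νn → expanding (S , τn<s , s<[1-τ]n , r<s+νn))

module _ {τ ε a b d d′} (τ≃ : Fraction τ (suc a) d) (τ<1 : τ <ℚ 1ℚ) (ε≃ : Fraction ε (suc b) d′) where

  private
    M : ℕ
    M = suc d * suc d′

  extremal⊎robustOutexpander : ∀ {ν p dν} → Fraction ν p dν → ν ≤ℚ ν₀ M →
    ∀ n → 8 * M ≤ n → (G : Digraph n) → MinSemiDegreeAtLeastHalf G → Extremal ε G ⊎ RobustOutexpander ν τ G
  extremal⊎robustOutexpander {ν} {p} {dν} ν≃ ν≤ν₀ n 8M≤n G δ⁰ =
    Sum.map₁ nonexpanding⇒extremal (Sum.swap (robustOutexpander⊎nonexpanding G ν τ))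
    where
    nonexpanding⇒extremal : ∃ (NonExpandingSet ν τ G) → Extremal ε G
    nonexpanding⇒extremal (S , τn<s , s<[1-τ]n , r<s+νn) = extremal (NonExpanding.nonexpanding⇒halves
      G δ⁰ (lookup S) (≤ν₀⇒16M²p≤q M ν≃ ν≤ν₀) 8M≤n (proj₁ window) (proj₂ window) nonexpanding)
      where
      window : n < M * # (lookup S) × M * # (lookup S) + n ≤ M * n
      window = subst (λ s → n < M * s × M * s + n ≤ M * n) (∣S∣≡# S) (τ-window τ≃ τ<1 (suc d′) τn<s s<[1-τ]n)
      nonexpanding : suc dν * # (RN G (lookup S) p (suc dν)) < suc dν * # (lookup S) + p * n
      nonexpanding = subst₂ (λ r s → suc dν * r < suc dν * s + p * n) (∣RN⁺∣≡#RN G S ν≃) (∣S∣≡# S)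
        (⟦⟧<fraction (⟦⟧+-fraction (*⟦⟧-fraction ν≃ n) ∣ S ∣) r<s+νn)
      extremal : (∃₂ λ X Y → # X ≡ ⌊ n /2⌋ × # Y ≡ ⌈ n /2⌉ × M * e G X Y < n * n) → Extremal ε G
      extremal (X , Y , #X , #Y , few) = halves⇒extremal G ε #X #Y (M*k<m⇒k<ε*m ε≃ (suc d) few)

lemma4p4 : (τ ε : ℚ) → 0ℚ <ℚ τ → τ <ℚ 1ℚ → 0ℚ <ℚ ε → ε <ℚ 1ℚ →
    ∃[ ν₀ ] (0ℚ <ℚ ν₀ × ((ν : ℚ) → 0ℚ <ℚ ν → ν ≤ℚ ν₀ →
    ∃[ n₀ ] ((n : ℕ) → n ℕ.≥ n₀ → (G : Digraph n) → MinSemiDegreeAtLeastHalf G →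
    Extremal ε G ⊎ RobustOutexpander ν τ G)))
lemma4p4 τ ε 0<τ τ<1 0<ε _ =
  let a , d , τ≃ = positive-fraction τ 0<τ
      b , d′ , ε≃ = positive-fraction ε 0<ε
      M = suc d * suc d′
  in ν₀ M , positive-threshold M , λ ν 0<ν ν≤ν₀ →
       let p , dν , ν≃ = positive-fraction ν 0<ν
       in 8 * M , extremal⊎robustOutexpander τ≃ τ<1 ε≃ ν≃ ν≤ν₀
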